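{- Let $P$ be a geometric lattice with minimum $\hat 0$ and rank function $r$. Then \[ q(P)+1=\min\{\, |(\hat 0,x)| : x\in P,\ r(x)=2 \,\}. \]
   Context: For $x<y$ in $P$, $(x,y)=\{z\in P: x<z<y\}$ is the open interval; it has length two if $r(y)=r(x)+2$. $q(P)$ is defined as the largest integer such that every open interval of length two in $P$ contains at least $q(P)+1$ elements (equivalently, the minimal width of intervals of length two, minus one). -}

module Defs where

open import Level using (0ℓ)
open import Data.Nat using (ℕ; suc; _+_) renaming (_≤_ to _≤ℕ_)
open import Data.Fin using (Fin; _≟_)
open import Data.List using (length; filter)
open import Data.Fin.Base using () renaming (Fin to F)
open import Data.List.Base using (List)
open import Data.Product using (Σ; ∃; _×_; _,_)
open import Data.Empty using (⊥)
open import Relation.Nullary using (¬_; Dec; yes; no)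
open import Relation.Nullary.Decidable using (_×-dec_; ¬?)
open import Relation.Binary.Core using (Rel)
open import Relation.Binary.Definitions using (Decidable)
open import Relation.Binary.PropositionalEquality using (_≡_; _≢_)
open import Relation.Binary.Lattice.Structures using (IsLattice)
import Data.List as L

allFin : (N : ℕ) → List (Fin N)
allFin N = Data.List.Base.allFin N
  where import Data.List.Base

record GeometricLattice (N : ℕ) : Set₁ where
  infix 4 _≤_ _<_ _⋖_
  field
    _≤_ : Rel (Fin N) 0ℓ
    _≤?_ : Decidable _≤_
    _∨_ : Fin N → Fin N → Fin N
    _∧_ : Fin N → Fin N → Fin N
    isLattice : IsLattice _≡_ _≤_ _∨_ _∧_
    bot : Fin N
    bot-min : ∀ x → bot ≤ x

  _<_ : Rel (Fin N) 0ℓ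
  x < y = x ≤ y × x ≢ y

  _<?_ : Decidable _<_
  x <? y = (x ≤? y) ×-dec ¬? (x ≟ y)

  _⋖_ : Rel (Fin N) 0ℓ
  x ⋖ y = x < y × (∀ z → x < z → z < y → ⊥)

  IsAtom : Fin N → Set
  IsAtom a = bot ⋖ a

  field
    r : Fin N → ℕ
    r-bot : r bot ≡ 0
    r-cover : ∀ x y → x ⋖ y → r y ≡ suc (r x)
    semimodular : ∀ x y → (x ∧ y) ⋖ x → y ⋖ (x ∨ y)
    -- atomistic: every x is the join (least upper bound) of the atoms below it
    atomistic : ∀ x y → (∀ a → IsAtom a → a ≤ x → a ≤ y) → x ≤ y

  ∣_,_∣ : Fin N → Fin N → ℕ
  ∣ x , y ∣ = length (filter (λ z → (x <? z) ×-dec (z <? y)) (allFin N))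

  LengthTwo : Fin N → Fin N → Set
  LengthTwo x y = x < y × r y ≡ r x + 2

  IsQ : ℕ → Set
  IsQ q = (∀ x y → LengthTwo x y → suc q ≤ℕ ∣ x , y ∣)
        × (∀ q' → (∀ x y → LengthTwo x y → suc q' ≤ℕ ∣ x , y ∣) → q' ≤ℕ q)

IsMinimum : (ℕ → Set) → ℕ → Set
IsMinimum S m = S m × (∀ n → S n → m ≤ℕ n)

-- Every open interval (x, y) of length two is at least as large as some interval
-- (0̂, z) with r(z) = 2, and the latter have length two themselves, so the minimal
-- width is attained above 0̂.  To find z, take an atom a ≤ y with a ≰ x; then
-- w = a ∨ x covers x, and an atom b ≤ y with b ≰ w gives z = a ∨ b of rank 2.
-- Every element u of (0̂, z) is an atom with u ≰ x, so by semimodularity u ∨ x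
-- covers x and lies in (x, y).  The map u ↦ u ∨ x is injective: two distinct
-- atoms below z join to z, and z ≤ u ∨ x would force u ∨ x = w ≥ b.
module Submission where

open import Defs
open import Level using (0ℓ)
open import Data.Nat using (ℕ; zero; suc; _+_; z≤n; s≤s) renaming (_≤_ to _≤ℕ_; _<_ to _<ℕ_)
open import Data.Nat.Properties as Nat
  using (≤∧≢⇒<; ≮⇒≥; <⇒≢; <⇒≱; <⇒≤; ≤-pred; ≤-refl; ≤-reflexive; n<1+n; +-comm; anyUpTo?)
open import Data.Nat.Induction using (<-wellFounded)
open import Data.Fin using (Fin; _≟_)
open import Data.Fin.Properties using (any?; all?)
open import Data.List using (List; []; _∷_; length; filter)
open import Data.List.Properties using (length-removeAt′)
open import Data.List.Membership.Propositional using (_∈_)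
open import Data.List.Membership.Propositional.Properties
  using (∈-filter⁺; ∈-filter⁻; ∈-allFin; ∈-length)
open import Data.List.Relation.Unary.Any using (here; there; _─_)
import Data.List.Relation.Unary.All as All
open import Data.List.Relation.Unary.AllPairs using (_∷_)
open import Data.List.Relation.Unary.Unique.Propositional using (Unique)
import Data.List.Relation.Unary.Unique.Propositional.Properties as Unique
open import Data.List.Relation.Binary.Sublist.Propositional using (_⊆_; ⊆-refl)
open import Data.List.Relation.Binary.Sublist.Propositional.Properties
  using (filter⁺; length-mono-≤; to-≋)
open import Data.List.Relation.Binary.Equality.Propositional using (≋⇒≡)
open import Data.Product using (Σ; ∃; _×_; _,_; proj₁; proj₂; curry; uncurry)
open import Data.Sum using (_⊎_; inj₁; inj₂)
open import Data.Empty using (⊥-elim)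
open import Induction.WellFounded using (Acc; acc)
open import Relation.Nullary using (¬_; Dec; yes; no)
open import Relation.Nullary.Decidable using (_×-dec_; ¬?; map′)
open import Relation.Unary using (Pred; Decidable)
open import Relation.Binary.PropositionalEquality
  using (_≡_; _≢_; refl; sym; trans; cong; subst)
open import Relation.Binary.Lattice.Structures using (IsLattice)

minimum-exists : {S : Pred ℕ 0ℓ} → Decidable S → ∀ {n} → S n → ∃ (IsMinimum S)
minimum-exists {S} S? = go (<-wellFounded _)
  where
  go : ∀ {n} → Acc _<ℕ_ n → S n → ∃ (IsMinimum S)
  go {n} (acc below) sn with anyUpTo? S? n
  ... | yes (m , m<n , sm) = go (below m<n) sm
  ... | no ∄smaller = n , sn , λ k sk → ≮⇒≥ (λ k<n → ∄smaller (k , k<n , sk))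

module _ {A : Set} {P Q : Pred A 0ℓ} (P? : Decidable P) (Q? : Decidable Q) where

  length-filter-< : (∀ {u} → P u → Q u) → ∀ {z xs} → z ∈ xs → Q z → ¬ P z →
                    length (filter P? xs) <ℕ length (filter Q? xs)
  length-filter-< P⇒Q {z} {xs} z∈xs qz ¬pz = ≤∧≢⇒< (length-mono-≤ filterP⊆filterQ) lengths≢
    where
    filterP⊆filterQ : filter P? xs ⊆ filter Q? xs
    filterP⊆filterQ = filter⁺ P? Q? (λ { refl → P⇒Q }) (⊆-refl {x = xs})
    lengths≢ : length (filter P? xs) ≢ length (filter Q? xs)
    lengths≢ eq = ¬pz (proj₂ (∈-filter⁻ P? {xs = xs}
      (subst (z ∈_) (sym (≋⇒≡ (to-≋ eq filterP⊆filterQ))) (∈-filter⁺ Q? z∈xs qz))))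

module _ {A : Set} where

  ∈-─⁺ : ∀ {x z : A} {ys} (x∈ys : x ∈ ys) → z ∈ ys → z ≢ x → z ∈ (ys ─ x∈ys)
  ∈-─⁺ (here refl) (here refl) z≢x = ⊥-elim (z≢x refl)
  ∈-─⁺ (here refl) (there z∈ys) _ = z∈ys
  ∈-─⁺ (there x∈ys) (here refl) _ = here refl
  ∈-─⁺ (there x∈ys) (there z∈ys) z≢x = there (∈-─⁺ x∈ys z∈ys z≢x)

module _ {A B : Set} where

  length-≤-injectiveOn : (f : A → B) {xs : List A} {ys : List B} → Unique xs →
    (∀ {u} → u ∈ xs → f u ∈ ys) →
    (∀ {u v} → u ∈ xs → v ∈ xs → f u ≡ f v → u ≡ v) →
    length xs ≤ℕ length ys
  length-≤-injectiveOn f {[]} _ _ _ = z≤n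
  length-≤-injectiveOn f {u ∷ xs} {ys} (u∉xs ∷ xs!) maps injective =
    subst (suc (length xs) ≤ℕ_) (sym (length-removeAt′ ys _))
      (s≤s (length-≤-injectiveOn f xs! maps′ (λ u∈ v∈ → injective (there u∈) (there v∈))))
    where
    fu∈ys : f u ∈ ys
    fu∈ys = maps (here refl)
    maps′ : ∀ {v} → v ∈ xs → f v ∈ (ys ─ fu∈ys)
    maps′ v∈xs = ∈-─⁺ fu∈ys (maps (there v∈xs))
      (λ fv≡fu → All.lookup u∉xs v∈xs (injective (here refl) (there v∈xs) (sym fv≡fu)))

module GeometricLatticeProperties {N : ℕ} (P : GeometricLattice N) where
  open GeometricLattice P
  open IsLattice isLattice using (x≤x∨y; y≤x∨y; ∨-least; x∧y≤x; x∧y≤y)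
    renaming (trans to ≤-trans′; antisym to ≤-antisym)

  <-trans : ∀ {x y z} → x < y → y < z → x < z
  <-trans (x≤y , x≢y) (y≤z , y≢z) = ≤-trans′ x≤y y≤z , λ { refl → y≢z (≤-antisym y≤z x≤y) }

  between? : ∀ x y → Decidable (λ z → x < z × z < y)
  between? x y z = (x <? z) ×-dec (z <? y)

  elementsBetween : Fin N → Fin N → List (Fin N)
  elementsBetween x y = filter (between? x y) (allFin N)

  ⋖-or-between : ∀ {x y} → x < y → x ⋖ y ⊎ ∃ λ z → x < z × z < y
  ⋖-or-between {x} {y} x<y with any? (between? x y)
  ... | yes between = inj₂ between
  ... | no ∄between = inj₁ (x<y , λ z x<z z<y → ∄between (z , x<z , z<y))

  _⋖?_ : ∀ x y → Dec (x ⋖ y)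
  x ⋖? y = (x <? y) ×-dec map′ (λ h z → curry (h z)) (λ h z → uncurry (h z))
                                (all? (λ z → ¬? (between? x y z)))

  ∣x,z∣<∣x,y∣ : ∀ {x y z} → x < z → z < y → ∣ x , z ∣ <ℕ ∣ x , y ∣
  ∣x,z∣<∣x,y∣ {x} {y} {z} x<z z<y =
    length-filter-< (between? x z) (between? x y) (λ (x<u , u<z) → x<u , <-trans u<z z<y)
                    (∈-allFin z) (x<z , z<y) (λ (_ , _ , z≢z) → z≢z refl)

  ∣z,y∣<∣x,y∣ : ∀ {x y z} → x < z → z < y → ∣ z , y ∣ <ℕ ∣ x , y ∣
  ∣z,y∣<∣x,y∣ {x} {y} {z} x<z z<y =
    length-filter-< (between? z y) (between? x y) (λ (z<u , u<y) → <-trans x<z z<u , u<y)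
                    (∈-allFin z) (x<z , z<y) (λ ((_ , z≢z) , _) → z≢z refl)

  r-strictMono : ∀ {x y} → x < y → r x <ℕ r y
  r-strictMono {x} {y} = go (<-wellFounded ∣ x , y ∣)
    where
    go : ∀ {x y} → Acc _<ℕ_ ∣ x , y ∣ → x < y → r x <ℕ r y
    go {x} {y} (acc smaller) x<y with ⋖-or-between x<y
    ... | inj₁ x⋖y = subst (r x <ℕ_) (sym (r-cover x y x⋖y)) (n<1+n (r x))
    ... | inj₂ (z , x<z , z<y) =
      Nat.<-trans (go (smaller (∣x,z∣<∣x,y∣ x<z z<y)) x<z) (go (smaller (∣z,y∣<∣x,y∣ x<z z<y)) z<y)

  ≤∧r≡⇒≡ : ∀ {u v} → u ≤ v → r u ≡ r v → u ≡ v
  ≤∧r≡⇒≡ {u} {v} u≤v ru≡rv with u ≟ v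
  ... | yes u≡v = u≡v
  ... | no u≢v = ⊥-elim (<⇒≢ (r-strictMono (u≤v , u≢v)) ru≡rv)

  r-atom : ∀ {a} → IsAtom a → r a ≡ 1
  r-atom {a} atom = trans (r-cover bot a atom) (cong suc r-bot)

  atom≤atom⇒≡ : ∀ {a b} → IsAtom a → IsAtom b → a ≤ b → a ≡ b
  atom≤atom⇒≡ {a} {b} atom-a atom-b a≤b with a ≟ b
  ... | yes a≡b = a≡b
  ... | no a≢b = ⊥-elim (proj₂ atom-b a (proj₁ atom-a) (a≤b , a≢b))

  atom∧≡bot : ∀ {a u} → IsAtom a → ¬ a ≤ u → a ∧ u ≡ bot
  atom∧≡bot {a} {u} atom a≰u with (a ∧ u) ≟ bot | (a ∧ u) ≟ a
  ... | yes a∧u≡bot | _ = a∧u≡bot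
  ... | no _ | yes a∧u≡a = ⊥-elim (a≰u (subst (_≤ u) a∧u≡a (x∧y≤y a u)))
  ... | no a∧u≢bot | no a∧u≢a =
    ⊥-elim (proj₂ atom (a ∧ u) (bot-min _ , λ e → a∧u≢bot (sym e)) (x∧y≤x a u , a∧u≢a))

  atom∨-covers : ∀ {a u} → IsAtom a → ¬ a ≤ u → u ⋖ a ∨ u
  atom∨-covers {a} {u} atom a≰u = semimodular a u (subst (_⋖ a) (sym (atom∧≡bot atom a≰u)) atom)

  r-atom∨ : ∀ {a u} → IsAtom a → ¬ a ≤ u → r (a ∨ u) ≡ suc (r u)
  r-atom∨ {a} {u} atom a≰u = r-cover u (a ∨ u) (atom∨-covers atom a≰u)

  atom-witness : ∀ {y u} → ¬ y ≤ u → ∃ λ a → IsAtom a × a ≤ y × ¬ a ≤ u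
  atom-witness {y} {u} y≰u with any? (λ a → (bot ⋖? a) ×-dec ((a ≤? y) ×-dec ¬? (a ≤? u)))
  ... | yes witness = witness
  ... | no ∄witness = ⊥-elim (y≰u (atomistic y u atoms≤u))
    where
    atoms≤u : ∀ a → IsAtom a → a ≤ y → a ≤ u
    atoms≤u a atom a≤y with a ≤? u
    ... | yes a≤u = a≤u
    ... | no a≰u = ⊥-elim (∄witness (a , atom , a≤y , a≰u))

  bot<rank2 : ∀ {z} → r z ≡ 2 → bot < z
  bot<rank2 {z} rz≡2 = bot-min z , λ bot≡z → <⇒≢ (s≤s z≤n) (trans (sym r-bot) (trans (cong r bot≡z) rz≡2))

  below-rank2-isAtom : ∀ {z u} → r z ≡ 2 → bot < u → u < z → IsAtom u
  below-rank2-isAtom {z} {u} rz≡2 bot<u u<z = bot<u , λ d bot<d d<u →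
    <⇒≱ (subst (r u <ℕ_) rz≡2 (r-strictMono u<z))
        (Nat.≤-trans (s≤s (subst (_<ℕ r d) r-bot (r-strictMono bot<d))) (r-strictMono d<u))

  ∨-distinct-atoms-rank2 : ∀ {z u v} → r z ≡ 2 → IsAtom u → IsAtom v → u ≢ v →
                           u ≤ z → v ≤ z → u ∨ v ≡ z
  ∨-distinct-atoms-rank2 rz≡2 atom-u atom-v u≢v u≤z v≤z =
    ≤∧r≡⇒≡ (∨-least u≤z v≤z)
      (trans (r-atom∨ atom-u (λ u≤v → u≢v (atom≤atom⇒≡ atom-u atom-v u≤v)))
             (trans (cong suc (r-atom atom-v)) (sym rz≡2)))

  0<∣bot,rank2∣ : ∀ {z} → r z ≡ 2 → 0 <ℕ ∣ bot , z ∣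
  0<∣bot,rank2∣ {z} rz≡2 with ⋖-or-between (bot<rank2 rz≡2)
  ... | inj₂ (u , between) = ∈-length (∈-filter⁺ (between? bot z) (∈-allFin u) between)
  ... | inj₁ bot⋖z = ⊥-elim (<⇒≢ (n<1+n 1)
                       (trans (cong suc (sym r-bot)) (trans (sym (r-cover bot z bot⋖z)) rz≡2)))

  r-mono : ∀ {u v} → u ≤ v → r u ≤ℕ r v
  r-mono {u} {v} u≤v with u ≟ v
  ... | yes refl = ≤-refl
  ... | no u≢v = <⇒≤ (r-strictMono (u≤v , u≢v))

  y≰atom∨x : ∀ {x y a} → r y ≡ r x + 2 → IsAtom a → ¬ a ≤ x → ¬ y ≤ a ∨ x
  y≰atom∨x {x} {y} {a} ry atom-a a≰x y≤a∨x = <⇒≱ (≤-reflexive (sym (trans ry (+-comm (r x) 2))))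
    (subst (r y ≤ℕ_) (r-atom∨ atom-a a≰x) (r-mono y≤a∨x))

  module LengthTwoInterval {x y} (x<y : x < y) (ry : r y ≡ r x + 2)
                           {a} (atom-a : IsAtom a) (a≤y : a ≤ y) (a≰x : ¬ a ≤ x)
                           {b} (atom-b : IsAtom b) (b≤y : b ≤ y) (b≰w : ¬ b ≤ a ∨ x) where

    r≡1+rx⇒≢y : ∀ {t} → r t ≡ suc (r x) → t ≢ y
    r≡1+rx⇒≢y rt refl = <⇒≢ (n<1+n (suc (r x))) (trans (sym rt) (trans ry (+-comm (r x) 2)))

    w : Fin N
    w = a ∨ x

    rw : r w ≡ suc (r x)
    rw = r-atom∨ atom-a a≰x

    z : Fin N
    z = b ∨ a

    rz : r z ≡ 2
    rz = trans (r-atom∨ atom-b (λ b≤a → b≰w (≤-trans′ b≤a (x≤x∨y a x))))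
               (cong suc (r-atom atom-a))

    z≰w : ¬ z ≤ w
    z≰w z≤w = b≰w (≤-trans′ (x≤x∨y b a) z≤w)

    atom≤z⇒≰x : ∀ {u} → IsAtom u → u ≤ z → ¬ u ≤ x
    atom≤z⇒≰x {u} atom-u u≤z u≤x = z≰w (subst (_≤ w) u∨a≡z
      (∨-least (≤-trans′ u≤x (y≤x∨y a x)) (x≤x∨y a x)))
      where
      u∨a≡z : u ∨ a ≡ z
      u∨a≡z = ∨-distinct-atoms-rank2 rz atom-u atom-a (λ { refl → a≰x u≤x }) u≤z (y≤x∨y b a)

    ∨x-injective : ∀ {u v} → IsAtom u → IsAtom v → u ≤ z → v ≤ z → u ∨ x ≡ v ∨ x → u ≡ v
    ∨x-injective {u} {v} atom-u atom-v u≤z v≤z u∨x≡v∨x with u ≟ v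
    ... | yes u≡v = u≡v
    ... | no u≢v = ⊥-elim (z≰w (subst (z ≤_) (sym w≡u∨x) z≤u∨x))
      where
      z≤u∨x : z ≤ u ∨ x
      z≤u∨x = subst (_≤ u ∨ x) (∨-distinct-atoms-rank2 rz atom-u atom-v u≢v u≤z v≤z)
                (∨-least (x≤x∨y u x) (subst (v ≤_) (sym u∨x≡v∨x) (x≤x∨y v x)))
      w≡u∨x : w ≡ u ∨ x
      w≡u∨x = ≤∧r≡⇒≡ (∨-least (≤-trans′ (y≤x∨y b a) z≤u∨x) (y≤x∨y u x))
                     (trans rw (sym (r-atom∨ atom-u (atom≤z⇒≰x atom-u u≤z))))

    between-bot-z⇒atom≤z : ∀ {u} → u ∈ elementsBetween bot z → IsAtom u × u ≤ z
    between-bot-z⇒atom≤z u∈ with (bot<u , u<z) ← proj₂ (∈-filter⁻ (between? bot z) {xs = allFin N} u∈) =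
      below-rank2-isAtom rz bot<u u<z , proj₁ u<z

    ∨x-maps : ∀ {u} → u ∈ elementsBetween bot z → u ∨ x ∈ elementsBetween x y
    ∨x-maps {u} u∈ with (atom-u , u≤z) ← between-bot-z⇒atom≤z u∈ =
      ∈-filter⁺ (between? x y) (∈-allFin (u ∨ x))
        (proj₁ (atom∨-covers atom-u (atom≤z⇒≰x atom-u u≤z)) ,
         ∨-least (≤-trans′ u≤z (∨-least b≤y a≤y)) (proj₁ x<y) ,
         r≡1+rx⇒≢y (r-atom∨ atom-u (atom≤z⇒≰x atom-u u≤z)))

    ∨x-injectiveOn : ∀ {u v} → u ∈ elementsBetween bot z → v ∈ elementsBetween bot z →
                     u ∨ x ≡ v ∨ x → u ≡ v
    ∨x-injectiveOn u∈ v∈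
      with (atom-u , u≤z) ← between-bot-z⇒atom≤z u∈ | (atom-v , v≤z) ← between-bot-z⇒atom≤z v∈ =
      ∨x-injective atom-u atom-v u≤z v≤z

    ∣bot,z∣≤∣x,y∣ : ∣ bot , z ∣ ≤ℕ ∣ x , y ∣
    ∣bot,z∣≤∣x,y∣ = length-≤-injectiveOn (_∨ x)
      (Unique.filter⁺ (between? bot z) (Unique.allFin⁺ N)) ∨x-maps ∨x-injectiveOn

  lengthTwo-dominates-rank2 : ∀ {x y} → LengthTwo x y → ∃ λ z → r z ≡ 2 × ∣ bot , z ∣ ≤ℕ ∣ x , y ∣
  lengthTwo-dominates-rank2 (x<y , ry)
    with a , atom-a , a≤y , a≰x ← atom-witness (λ y≤x → proj₂ x<y (≤-antisym (proj₁ x<y) y≤x))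
    with b , atom-b , b≤y , b≰w ← atom-witness (y≰atom∨x ry atom-a a≰x) =
    z , rz , ∣bot,z∣≤∣x,y∣
    where open LengthTwoInterval x<y ry atom-a a≤y a≰x atom-b b≤y b≰w

  Rank2IntervalSize : Pred ℕ 0ℓ
  Rank2IntervalSize n = ∃ λ z → r z ≡ 2 × ∣ bot , z ∣ ≡ n

  Rank2IntervalSize? : Decidable Rank2IntervalSize
  Rank2IntervalSize? n = any? (λ z → (r z Nat.≟ 2) ×-dec (∣ bot , z ∣ Nat.≟ n))

  minimum⇒IsQ : ∀ {m} → IsMinimum Rank2IntervalSize m →
                Σ ℕ λ q → IsQ q × IsMinimum Rank2IntervalSize (suc q)
  minimum⇒IsQ {zero} ((z , rz , ∣bot,z∣≡0) , _) = ⊥-elim (<⇒≢ (0<∣bot,rank2∣ rz) (sym ∣bot,z∣≡0))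
  minimum⇒IsQ {suc q} minimum@((z , rz , ∣bot,z∣≡1+q) , minimal) = q , (lowerBound , greatest) , minimum
    where
    lowerBound : ∀ x y → LengthTwo x y → suc q ≤ℕ ∣ x , y ∣
    lowerBound x y xy =
      let z′ , rz′ , ∣bot,z′∣≤∣x,y∣ = lengthTwo-dominates-rank2 xy
      in Nat.≤-trans (minimal _ (z′ , rz′ , refl)) ∣bot,z′∣≤∣x,y∣
    greatest : ∀ q′ → (∀ x y → LengthTwo x y → suc q′ ≤ℕ ∣ x , y ∣) → q′ ≤ℕ q
    greatest q′ bound = ≤-pred (subst (suc q′ ≤ℕ_) ∣bot,z∣≡1+q
      (bound bot z (bot<rank2 rz , trans rz (cong (_+ 2) (sym r-bot)))))

mainTheorem4 : ∀ {N : ℕ} (P : GeometricLattice N) →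
    let open GeometricLattice P in
    (∃ λ (x : Fin N) → r x ≡ 2) →
    Σ ℕ λ q → IsQ q × IsMinimum (λ n → ∃ λ (x : Fin N) → r x ≡ 2 × ∣ bot , x ∣ ≡ n) (suc q)
mainTheorem4 P (x , rx) = minimum⇒IsQ (proj₂ (minimum-exists Rank2IntervalSize? (x , rx , refl)))
  where open GeometricLatticeProperties P
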